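{- For every integer $t\ge2$, \[m_5(\mathbb{Z}_{37t})\le\frac{36+m_5(\mathbb{Z}_t)}{37^2}.\]
   Context: A $k$-AP in $\mathbb{Z}_n$ is an ordered sequence $(a,a+d,\dots,a+(k-1)d)$ with $(a,d)\in\mathbb{Z}_n^2$; degenerate progressions are allowed and there are exactly $n^2$ of them. For $c:\mathbb{Z}_n\to\{0,1\}$, $m_k(\mathbb{Z}_n,c)$ is the number of pairs $(a,d)$ whose $k$-AP is monochromatic, and $m_k(\mathbb{Z}_n)=\min_c m_k(\mathbb{Z}_n,c)/n^2$. -}

module Defs where

open import Data.Bool using (Bool; true; false; _∧_; _∨_; not; if_then_else_)
open import Data.Nat using (ℕ; zero; suc; _+_; _*_; _⊓_)
open import Data.Nat.DivMod using (_mod_)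
open import Data.Fin using (Fin; toℕ)
open import Data.Fin.Properties using (_≟_)
open import Data.List using (List; []; _∷_; map; concatMap; foldr; allFin; upTo)
open import Data.Bool.ListAction using (and)
open import Data.Nat.ListAction using (sum)
open import Data.Integer using (+_)
open import Data.Rational using (ℚ; _/_)
open import Relation.Nullary.Decidable using (⌊_⌋)

Coloring : ℕ → Set
Coloring n = Fin n → Bool

allColorings : (n : ℕ) → List (Coloring n)
allColorings zero = (λ ()) ∷ []
allColorings (suc n) =
  concatMap (λ c → ext false c ∷ ext true c ∷ []) (allColorings n)
  where
    ext : Bool → Coloring n → Coloring (suc n)
    ext b c Fin.zero    = b
    ext b c (Fin.suc i) = c i

apTerm : (p : ℕ) → Fin (suc p) → Fin (suc p) → ℕ → Fin (suc p)
apTerm p a d i = (toℕ a + i * toℕ d) mod (suc p)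

isMono : (k p : ℕ) → Coloring (suc p) → Fin (suc p) → Fin (suc p) → Bool
isMono k p c a d =
  and (map (λ i → eqB (c (apTerm p a d i)) (c a)) (upTo k))
  where
    eqB : Bool → Bool → Bool
    eqB x y = (x ∧ y) ∨ (not x ∧ not y)

-- m_k(ℤ_n, c): number of pairs (a,d) ∈ ℤ_n² whose k-AP is monochromatic
-- (degenerate progressions d = 0 included).
monoCount : (k p : ℕ) → Coloring (suc p) → ℕ
monoCount k p c =
  sum (concatMap (λ a → map (λ d → if isMono k p c a d then 1 else 0)
                            (allFin (suc p)))
                 (allFin (suc p)))

-- min over all colourings of monoCount; the seed n² is an upper bound of
-- every monoCount (there are only n² pairs), so it does not affect the min.
minMonoCount : (k p : ℕ) → ℕ
minMonoCount k p =
  foldr (λ c acc → monoCount k p c ⊓ acc) (suc p * suc p) (allColorings (suc p))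

-- m_k(ℤ_n) = min_c m_k(ℤ_n, c) / n², as a rational, for n ≥ 1.
-- (ℤ_0 is not meaningful; we set m_k(ℤ_0) = 0, it is never used.)
m : (k n : ℕ) → ℚ
m k zero    = + 0 / 1
m k (suc p) = + minMonoCount k p / (suc p * suc p)

-- Fix a 2-colouring f of the nonzero residues mod M = m + 1 which is
-- rigid for k-APs: along every progression r, r+s, …, r+(k-1)s mod M with
-- s ≢ 0 the nonzero residues do not all carry one colour.  Given a colouring
-- c of ℤ_t, colour ℤ_{Mt} by  y ↦ c(y/M) if M ∣ y  and  y ↦ f(y mod M)
-- otherwise.  A k-AP (a,d) of ℤ_{Mt} can then only be monochromatic if M ∣ d.
-- If moreover M ∣ a, it is monochromatic exactly when the AP (a/M, d/M) of
-- ℤ_t is; the remaining m·t·t pairs (M ∤ a, M ∣ d) contribute at most one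
-- each.  Hence  min-count(ℤ_{Mt}) ≤ min-count(ℤ_t) + m t², which after
-- division by (Mt)² is the claimed inequality.  For M = 37 and k = 5 the
-- quadratic character mod 37 is rigid, which is checked by evaluation.
module Submission where

open import Defs
open import Algebra.Properties.CommutativeSemigroup using (interchange)
open import Data.Bool using (Bool; true; false; T; _∧_; _∨_; not; if_then_else_)
open import Data.Empty using (⊥-elim)
open import Data.Fin using (Fin; toℕ)
import Data.Fin as Fin
open import Data.Fin.Properties using (toℕ-injective; toℕ-fromℕ<; toℕ<n)
open import Data.List using (List; []; _∷_; map; concatMap; foldr; allFin; upTo; tabulate)
open import Data.List.Properties using (map-cong; concatMap-cong; map-tabulate)
import Data.List.Relation.Unary.All as All
open import Data.List.Relation.Unary.All.Properties using (all⁺; all⁻)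
open import Data.List.Relation.Unary.Any as Any using (Any; here; there)
open import Data.List.Relation.Unary.Any.Properties using (concatMap⁺)
open import Data.Bool.ListAction using (and; all)
open import Data.Nat using (ℕ; zero; suc; _+_; _*_; _^_; _≤_; _<_; _⊓_; _≡ᵇ_; z≤n; s≤s; NonZero; pred)
open import Data.Nat.Properties
open import Data.Nat.DivMod
open import Data.Nat.Divisibility using (divides)
open import Data.Nat.ListAction using (sum)
open import Data.Nat.ListAction.Properties using (sum-++)
open import Function using (_∘_)
open import Data.Nat.Solver using (module +-*-Solver)
import Data.Integer as ℤ
import Data.Integer.Properties as ℤP
import Data.Rational as ℚ
import Data.Rational.Properties as ℚP
import Data.Rational.Unnormalised as ℚᵘ
open import Data.Rational.Unnormalised using (mkℚᵘ)
import Data.Rational.Unnormalised.Properties as ℚᵘP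
open import Relation.Binary.PropositionalEquality
open import Relation.Nullary using (¬_; Dec)
open import Relation.Nullary.Decidable using (toWitness; ¬?; _→-dec_; T?)

∑ : ℕ → (ℕ → ℕ) → ℕ
∑ zero    f = 0
∑ (suc n) f = f 0 + ∑ n (λ i → f (suc i))

syntax ∑ n (λ i → e) = ∑[ i < n ] e

∑-cong : ∀ n {f g : ℕ → ℕ} → (∀ i → f i ≡ g i) → ∑ n f ≡ ∑ n g
∑-cong zero    f≡g = refl
∑-cong (suc n) f≡g = cong₂ _+_ (f≡g 0) (∑-cong n (f≡g ∘ suc))

∑-mono : ∀ n {f g : ℕ → ℕ} → (∀ i → f i ≤ g i) → ∑ n f ≤ ∑ n g
∑-mono zero    f≤g = z≤n
∑-mono (suc n) f≤g = +-mono-≤ (f≤g 0) (∑-mono n (λ i → f≤g (suc i)))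

∑-const : ∀ n c → ∑[ _ < n ] c ≡ n * c
∑-const zero    c = refl
∑-const (suc n) c = cong (c +_) (∑-const n c)

∑-+ : ∀ n (f g : ℕ → ℕ) → ∑[ i < n ] (f i + g i) ≡ ∑ n f + ∑ n g
∑-+ zero    f g = refl
∑-+ (suc n) f g = begin
  (f 0 + g 0) + ∑[ i < n ] (f (suc i) + g (suc i))
    ≡⟨ cong ((f 0 + g 0) +_) (∑-+ n (f ∘ suc) (g ∘ suc)) ⟩
  (f 0 + g 0) + (∑ n (f ∘ suc) + ∑ n (g ∘ suc))
    ≡⟨ interchange +-commutativeSemigroup (f 0) (g 0) _ _ ⟩
  (f 0 + ∑ n (f ∘ suc)) + (g 0 + ∑ n (g ∘ suc)) ∎
  where open ≡-Reasoning

∑-vanish : ∀ n {f : ℕ → ℕ} → (∀ i → i < n → f i ≡ 0) → ∑ n f ≡ 0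
∑-vanish zero    f≡0 = refl
∑-vanish (suc n) f≡0 =
  cong₂ _+_ (f≡0 0 (s≤s z≤n)) (∑-vanish n (λ i i<n → f≡0 (suc i) (s≤s i<n)))

∑-split-+ : ∀ m n f → ∑ (m + n) f ≡ ∑ m f + ∑[ i < n ] f (m + i)
∑-split-+ zero    n f = refl
∑-split-+ (suc m) n f =
  trans (cong (f 0 +_) (∑-split-+ m n (λ i → f (suc i)))) (sym (+-assoc (f 0) _ _))

∑-split-* : ∀ t M f → ∑ (t * M) f ≡ ∑[ q < t ] ∑[ r < M ] f (q * M + r)
∑-split-* zero    M f = refl
∑-split-* (suc t) M f = begin
  ∑ (M + t * M) f
    ≡⟨ ∑-split-+ M (t * M) f ⟩
  ∑ M f + ∑[ i < t * M ] f (M + i)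
    ≡⟨ cong (∑ M f +_) (∑-split-* t M (λ i → f (M + i))) ⟩
  ∑ M f + ∑[ q < t ] ∑[ r < M ] f (M + (q * M + r))
    ≡⟨ cong (∑ M f +_) (∑-cong t (λ q → ∑-cong M (λ r → cong f (sym (+-assoc M (q * M) r))))) ⟩
  ∑ M f + ∑[ q < t ] ∑[ r < M ] f (M + q * M + r) ∎
  where open ≡-Reasoning

𝟙 : Bool → ℕ
𝟙 b = if b then 1 else 0

𝟙≤1 : ∀ b → 𝟙 b ≤ 1
𝟙≤1 true  = ≤-refl
𝟙≤1 false = z≤n

𝟙-false : ∀ {b} → ¬ T b → 𝟙 b ≡ 0
𝟙-false {true}  ¬b = ⊥-elim (¬b _)
𝟙-false {false} ¬b = refl

∑-𝟙≤ : ∀ n (b : ℕ → Bool) → ∑[ i < n ] 𝟙 (b i) ≤ n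
∑-𝟙≤ n b = ≤-trans (∑-mono n (λ i → 𝟙≤1 (b i))) (≤-reflexive (trans (∑-const n 1) (*-identityʳ n)))

-- List sums are converted to ∑, where index arithmetic is available.
sum-concatMap : ∀ {A : Set} (g : A → List ℕ) (xs : List A) →
  sum (concatMap g xs) ≡ sum (map (sum ∘ g) xs)
sum-concatMap g []       = refl
sum-concatMap g (x ∷ xs) = trans (sum-++ (g x) _) (cong (sum (g x) +_) (sum-concatMap g xs))

sum-tabulate : ∀ n (h : Fin n → ℕ) (H : ℕ → ℕ) → (∀ x → h x ≡ H (toℕ x)) →
  sum (tabulate h) ≡ ∑ n H
sum-tabulate zero    h H h≡H = refl
sum-tabulate (suc n) h H h≡H =
  cong₂ _+_ (h≡H Fin.zero) (sum-tabulate n (h ∘ Fin.suc) (H ∘ suc) (h≡H ∘ Fin.suc))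

toℕ-mod : ∀ y n .{{_ : NonZero n}} → toℕ (y mod n) ≡ y % n
toℕ-mod y n = toℕ-fromℕ< (m%n<n y n)

mod-toℕ : ∀ n (x : Fin (suc n)) → toℕ x mod suc n ≡ x
mod-toℕ n x = toℕ-injective (trans (toℕ-mod (toℕ x) (suc n)) (m<n⇒m%n≡m (toℕ<n x)))

sum-pairs : ∀ p (F : Fin (suc p) → Fin (suc p) → ℕ) →
  sum (concatMap (λ a → map (F a) (allFin (suc p))) (allFin (suc p)))
    ≡ ∑[ a < suc p ] ∑[ d < suc p ] F (a mod suc p) (d mod suc p)
sum-pairs p F = begin
  sum (concatMap row (allFin n))      ≡⟨ sum-concatMap row (allFin n) ⟩
  sum (map (sum ∘ row) (allFin n))    ≡⟨ cong sum (map-tabulate (λ a → a) (sum ∘ row)) ⟩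
  sum (tabulate (sum ∘ row))          ≡⟨ sum-tabulate n (sum ∘ row) (λ a → ∑[ d < n ] F (a mod n) (d mod n)) rowSum ⟩
  ∑[ a < n ] ∑[ d < n ] F (a mod n) (d mod n) ∎
  where
  open ≡-Reasoning
  n = suc p
  row : Fin n → List ℕ
  row a = map (F a) (allFin n)
  rowSum : ∀ a → sum (row a) ≡ ∑[ d < n ] F (toℕ a mod n) (d mod n)
  rowSum a = trans (cong sum (map-tabulate (λ d → d) (F a)))
    (sum-tabulate n (F a) (λ d → F (toℕ a mod n) (d mod n)) (λ d → cong₂ F (sym (mod-toℕ p a)) (sym (mod-toℕ p d))))

monoCount-∑ : ∀ k p (c : Coloring (suc p)) →
  monoCount k p c ≡ ∑[ a < suc p ] ∑[ d < suc p ] 𝟙 (isMono k p c (a mod suc p) (d mod suc p))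
monoCount-∑ k p c = sum-pairs p (λ a d → 𝟙 (isMono k p c a d))

monoCount≤ : ∀ k p (c : Coloring (suc p)) → monoCount k p c ≤ suc p * suc p
monoCount≤ k p c = begin
  monoCount k p c                 ≡⟨ monoCount-∑ k p c ⟩
  ∑[ a < n ] ∑[ d < n ] 𝟙 (isMono k p c (a mod n) (d mod n))
    ≤⟨ ∑-mono n (λ a → ∑-𝟙≤ n (λ d → isMono k p c (a mod n) (d mod n))) ⟩
  ∑[ _ < n ] n                    ≡⟨ ∑-const n n ⟩
  n * n ∎
  where
  open ≤-Reasoning
  n = suc p

-- Boolean equality, the test isMono applies to the colours of a and of each term.
agree : Bool → Bool → Bool
agree x y = (x ∧ y) ∨ (not x ∧ not y)

isMono-cong : ∀ k p {c c′ : Coloring (suc p)} → c ≗ c′ → ∀ a d → isMono k p c a d ≡ isMono k p c′ a d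
isMono-cong k p c≗c′ a d =
  cong and (map-cong (λ i → cong₂ agree (c≗c′ (apTerm p a d i)) (c≗c′ a)) (upTo k))

-- Hence so does monoCount; needed because allColorings contains colourings
-- only up to pointwise equality.
monoCount-cong : ∀ k p {c c′ : Coloring (suc p)} → c ≗ c′ → monoCount k p c ≡ monoCount k p c′
monoCount-cong k p c≗c′ = cong sum (concatMap-cong
  (λ a → map-cong (λ d → cong 𝟙 (isMono-cong k p c≗c′ a d)) (allFin _)) (allFin _))

allColorings-complete : ∀ n (c : Coloring n) → Any (_≗ c) (allColorings n)
allColorings-complete zero    c = here (λ ())
allColorings-complete (suc n) c with c Fin.zero in c0
... | false = concatMap⁺ _ (Any.map (λ tail≗ → here
                (λ { Fin.zero → sym c0 ; (Fin.suc x) → tail≗ x })) (allColorings-complete n (c ∘ Fin.suc)))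
... | true  = concatMap⁺ _ (Any.map (λ tail≗ → there (here
                (λ { Fin.zero → sym c0 ; (Fin.suc x) → tail≗ x }))) (allColorings-complete n (c ∘ Fin.suc)))

foldr-⊓-≤ : ∀ {A : Set} (g : A → ℕ) s {xs : List A} {v} →
  Any (λ x → g x ≤ v) xs → foldr (λ x acc → g x ⊓ acc) s xs ≤ v
foldr-⊓-≤ g s {x ∷ _} (here gx≤v) = ≤-trans (m⊓n≤m (g x) _) gx≤v
foldr-⊓-≤ g s {x ∷ _} (there any) = ≤-trans (m⊓n≤n (g x) _) (foldr-⊓-≤ g s any)

foldr-⊓-glb : ∀ {A : Set} (g : A → ℕ) s (xs : List A) {Z} K →
  Z ≤ s + K → (∀ x → Z ≤ g x + K) → Z ≤ foldr (λ x acc → g x ⊓ acc) s xs + K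
foldr-⊓-glb g s []       K Z≤s Z≤g = Z≤s
foldr-⊓-glb g s (x ∷ xs) K Z≤s Z≤g =
  subst (_ ≤_) (sym (+-distribʳ-⊓ K (g x) _)) (⊓-glb (Z≤g x) (foldr-⊓-glb g s xs K Z≤s Z≤g))

minMonoCount≤ : ∀ k p (c : Coloring (suc p)) → minMonoCount k p ≤ monoCount k p c
minMonoCount≤ k p c = foldr-⊓-≤ (monoCount k p) (suc p * suc p)
  (Any.map (λ c′≗c → ≤-reflexive (monoCount-cong k p c′≗c)) (allColorings-complete (suc p) c))

minMonoCount-transfer : ∀ k p P K (F : Coloring (suc p) → Coloring (suc P)) →
  (∀ c → monoCount k P (F c) ≤ monoCount k p c + K) →
  minMonoCount k P ≤ minMonoCount k p + K
minMonoCount-transfer k p P K F bound =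
  foldr-⊓-glb (monoCount k p) (suc p * suc p) (allColorings (suc p)) K seed viaF
  where
  viaF : ∀ c → minMonoCount k P ≤ monoCount k p c + K
  viaF c = ≤-trans (minMonoCount≤ k P (F c)) (bound c)
  seed : minMonoCount k P ≤ suc p * suc p + K
  seed = ≤-trans (viaF (λ _ → false)) (+-monoˡ-≤ K (monoCount≤ k p (λ _ → false)))

affine-%-cong : ∀ M .{{_ : NonZero M}} i {x x′ y y′} → x % M ≡ x′ % M → y % M ≡ y′ % M →
  (x + i * y) % M ≡ (x′ + i * y′) % M
affine-%-cong M i {x} {x′} {y} {y′} x≡x′ y≡y′ = begin
  (x + i * y) % M                              ≡⟨ %-distribˡ-+ x (i * y) M ⟩
  (x % M + (i * y) % M) % M                    ≡⟨ cong (λ z → (x % M + z) % M) (%-distribˡ-* i y M) ⟩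
  (x % M + (i % M * (y % M)) % M) % M          ≡⟨ cong₂ (λ u v → (u + (i % M * v) % M) % M) x≡x′ y≡y′ ⟩
  (x′ % M + (i % M * (y′ % M)) % M) % M        ≡⟨ cong (λ z → (x′ % M + z) % M) (%-distribˡ-* i y′ M) ⟨
  (x′ % M + (i * y′) % M) % M                  ≡⟨ %-distribˡ-+ x′ (i * y′) M ⟨
  (x′ + i * y′) % M ∎
  where open ≡-Reasoning

-- The residue z mod m+1 is 0 (so its colour in the blow-up is free) or has colour X under f.
zeroOrColoured : (ℕ → Bool) → Bool → ℕ → Bool
zeroOrColoured f X z = (z ≡ᵇ 0) ∨ agree (f z) X

residuesMono : (k m : ℕ) → (ℕ → Bool) → (r s : ℕ) → Bool → Bool
residuesMono k m f r s X = all (λ i → zeroOrColoured f X ((r + i * s) % suc m)) (upTo k)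

Rigid : (k m : ℕ) → (ℕ → Bool) → Set
Rigid k m f = ∀ X {r s} → r < suc m → s < suc m → 0 < s → ¬ T (residuesMono k m f r s X)

module BlowUp (k m p : ℕ) (f : ℕ → Bool) (c : Coloring (suc p)) where

  M t P N : ℕ
  M = suc m
  t = suc p
  P = p + m * t
  N = suc P

  N≡t*M : N ≡ t * M
  N≡t*M = *-comm M t

  colour : ℕ → Bool
  colour y = if y % M ≡ᵇ 0 then c ((y / M) mod t) else f (y % M)

  C : Coloring N
  C x = colour (toℕ x)

  colour-multiple : ∀ u → colour (u * M) ≡ c (u mod t)
  colour-multiple u = begin
    colour (u * M)
      ≡⟨ cong (λ z → if z ≡ᵇ 0 then c ((u * M / M) mod t) else f z) (m*n%n≡0 u M) ⟩
    c ((u * M / M) mod t)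
      ≡⟨ cong (λ v → c (v mod t)) (m*n/n≡m u M) ⟩
    c (u mod t) ∎
    where open ≡-Reasoning

  mod-mod : ∀ z → (z % t) mod t ≡ z mod t
  mod-mod z = toℕ-injective (trans (toℕ-mod (z % t) t) (trans (m%n%n≡m%n z t) (sym (toℕ-mod z t))))

  toℕ-multiple : ∀ u → toℕ ((u * M) mod N) ≡ (u % t) * M
  toℕ-multiple u = trans (toℕ-mod (u * M) N) (trans (%-congʳ {o = u * M} N≡t*M) (sym (m%n*o≡m*o%[n*o] u t M)))

  C-multiple : ∀ u → C ((u * M) mod N) ≡ c (u mod t)
  C-multiple u = begin
    colour (toℕ ((u * M) mod N)) ≡⟨ cong colour (toℕ-multiple u) ⟩
    colour ((u % t) * M)         ≡⟨ colour-multiple (u % t) ⟩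
    c ((u % t) mod t)            ≡⟨ cong c (mod-mod u) ⟩
    c (u mod t) ∎
    where open ≡-Reasoning

  diagonal : ∀ q q′ → isMono k P C ((q * M) mod N) ((q′ * M) mod N) ≡ isMono k p c (q mod t) (q′ mod t)
  diagonal q q′ = cong and (map-cong (λ i → cong₂ agree (term i) (C-multiple q)) (upTo k))
    where
    open ≡-Reasoning
    term : ∀ i → C (apTerm P ((q * M) mod N) ((q′ * M) mod N) i) ≡ c (apTerm p (q mod t) (q′ mod t) i)
    term i = begin
      C ((toℕ ((q * M) mod N) + i * toℕ ((q′ * M) mod N)) mod N)
        ≡⟨ cong₂ (λ x y → C ((x + i * y) mod N)) (toℕ-multiple q) (toℕ-multiple q′) ⟩
      C ((q % t * M + i * (q′ % t * M)) mod N)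
        ≡⟨ cong (λ z → C (z mod N)) (multiple-sum (q % t) (q′ % t)) ⟩
      C (((q % t + i * (q′ % t)) * M) mod N)
        ≡⟨ C-multiple (q % t + i * (q′ % t)) ⟩
      c ((q % t + i * (q′ % t)) mod t)
        ≡⟨ cong₂ (λ x y → c ((x + i * y) mod t)) (toℕ-mod q t) (toℕ-mod q′ t) ⟨
      c ((toℕ (q mod t) + i * toℕ (q′ mod t)) mod t) ∎
      where
      multiple-sum : ∀ x y → x * M + i * (y * M) ≡ (x + i * y) * M
      multiple-sum x y = sym (trans (*-distribʳ-+ M x (i * y)) (cong (x * M +_) (*-assoc i y M)))

  term-residue : ∀ a d i → toℕ (apTerm P (a mod N) (d mod N) i) % M ≡ (a % M + i * (d % M)) % M
  term-residue a d i = begin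
    toℕ (apTerm P (a mod N) (d mod N) i) % M
      ≡⟨ cong (_% M) (toℕ-mod (toℕ (a mod N) + i * toℕ (d mod N)) N) ⟩
    (toℕ (a mod N) + i * toℕ (d mod N)) % N % M
      ≡⟨ cong₂ (λ x y → (x + i * y) % N % M) (toℕ-mod a N) (toℕ-mod d N) ⟩
    (a % N + i * (d % N)) % N % M
      ≡⟨ reduce (a % N + i * (d % N)) ⟩
    (a % N + i * (d % N)) % M
      ≡⟨ affine-%-cong M i {a % N} {a % M} {d % N} {d % M} (residue a) (residue d) ⟩
    (a % M + i * (d % M)) % M ∎
    where
    open ≡-Reasoning
    reduce : ∀ y → y % N % M ≡ y % M
    reduce y = m∣n⇒o%n%m≡o%m M N y (divides t N≡t*M)
    residue : ∀ y → y % N % M ≡ y % M % M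
    residue y = trans (reduce y) (sym (m%n%n≡m%n y M))

  colour-zeroOrColoured : ∀ y X → T (agree (colour y) X) → T (zeroOrColoured f X (y % M))
  colour-zeroOrColoured y X with y % M ≡ᵇ 0
  ... | true  = λ _ → _
  ... | false = λ agrees → agrees

  mono⇒residuesMono : ∀ a d → T (isMono k P C (a mod N) (d mod N)) →
    T (residuesMono k m f (a % M) (d % M) (C (a mod N)))
  mono⇒residuesMono a d mono = all⁻ _ (All.map
    (λ {i} agrees → subst (T ∘ zeroOrColoured f X) (term-residue a d i)
                           (colour-zeroOrColoured (toℕ (apTerm P (a mod N) (d mod N) i)) X agrees))
    (all⁺ _ (upTo k) mono))
    where
    X : Bool
    X = C (a mod N)

  offDiagonal : Rigid k m f → ∀ a d → 0 < d % M → 𝟙 (isMono k P C (a mod N) (d mod N)) ≡ 0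
  offDiagonal rigid a d 0<d%M =
    𝟙-false (rigid (C (a mod N)) (m%n<n a M) (m%n<n d M) 0<d%M ∘ mono⇒residuesMono a d)

  monoᴺ : ℕ → ℕ → ℕ
  monoᴺ a d = 𝟙 (isMono k P C (a mod N) (d mod N))

  monoᵗ : ℕ → ℕ → ℕ
  monoᵗ q q′ = 𝟙 (isMono k p c (q mod t) (q′ mod t))

  rowSum : Rigid k m f → ∀ a → ∑ N (monoᴺ a) ≡ ∑[ q′ < t ] monoᴺ a (q′ * M)
  rowSum rigid a = begin
    ∑ N (monoᴺ a)                                  ≡⟨ cong (λ n → ∑ n (monoᴺ a)) N≡t*M ⟩
    ∑ (t * M) (monoᴺ a)                            ≡⟨ ∑-split-* t M (monoᴺ a) ⟩
    ∑[ q′ < t ] ∑[ r < M ] monoᴺ a (q′ * M + r)    ≡⟨ ∑-cong t block ⟩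
    ∑[ q′ < t ] monoᴺ a (q′ * M) ∎
    where
    open ≡-Reasoning
    residue : ∀ q′ s → s < m → (q′ * M + suc s) % M ≡ suc s
    residue q′ s s<m = trans (%-remove-+ˡ (suc s) (divides q′ refl)) (m<n⇒m%n≡m (s≤s s<m))
    block : ∀ q′ → ∑[ r < M ] monoᴺ a (q′ * M + r) ≡ monoᴺ a (q′ * M)
    block q′ = begin
      monoᴺ a (q′ * M + 0) + ∑[ s < m ] monoᴺ a (q′ * M + suc s)
        ≡⟨ cong₂ _+_ (cong (monoᴺ a) (+-identityʳ (q′ * M)))
                     (∑-vanish m (λ s s<m → offDiagonal rigid a (q′ * M + suc s)
                                              (subst (0 <_) (sym (residue q′ s s<m)) (s≤s z≤n)))) ⟩
      monoᴺ a (q′ * M) + 0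
        ≡⟨ +-identityʳ _ ⟩
      monoᴺ a (q′ * M) ∎

  -- The blow-up adds at most m·t·t monochromatic APs: those with M ∤ a, M ∣ d.
  countBound : Rigid k m f → monoCount k P C ≤ monoCount k p c + t * (m * t)
  countBound rigid = begin
    monoCount k P C                                ≡⟨ monoCount-∑ k P C ⟩
    ∑[ a < N ] ∑ N (monoᴺ a)                       ≡⟨ ∑-cong N (rowSum rigid) ⟩
    ∑ N R                                          ≡⟨ cong (λ n → ∑ n R) N≡t*M ⟩
    ∑ (t * M) R                                    ≡⟨ ∑-split-* t M R ⟩
    ∑[ q < t ] ∑[ r < M ] R (q * M + r)            ≤⟨ ∑-mono t block ⟩
    ∑[ q < t ] (∑ t (monoᵗ q) + m * t)             ≡⟨ ∑-+ t (λ q → ∑ t (monoᵗ q)) (λ _ → m * t) ⟩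
    ∑[ q < t ] ∑ t (monoᵗ q) + ∑[ _ < t ] (m * t)  ≡⟨ cong₂ _+_ (sym (monoCount-∑ k p c)) (∑-const t (m * t)) ⟩
    monoCount k p c + t * (m * t) ∎
    where
    open ≤-Reasoning
    R : ℕ → ℕ
    R a = ∑[ q′ < t ] monoᴺ a (q′ * M)
    -- Start a = q·M copies the row q of ℤ_t; the other m starts give ≤ t each.
    diagonalRow : ∀ q → R (q * M + 0) ≡ ∑ t (monoᵗ q)
    diagonalRow q = ∑-cong t (λ q′ →
      trans (cong (λ a → monoᴺ a (q′ * M)) (+-identityʳ (q * M))) (cong 𝟙 (diagonal q q′)))
    block : ∀ q → ∑[ r < M ] R (q * M + r) ≤ ∑ t (monoᵗ q) + m * t
    block q = +-mono-≤ (≤-reflexive (diagonalRow q)) (begin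
      ∑[ r < m ] R (q * M + suc r)
        ≤⟨ ∑-mono m (λ r → ∑-𝟙≤ t (λ q′ → isMono k P C ((q * M + suc r) mod N) ((q′ * M) mod N))) ⟩
      ∑[ _ < m ] t                 ≡⟨ ∑-const m t ⟩
      m * t ∎)

blowUp-min : ∀ k m p (f : ℕ → Bool) → Rigid k m f →
  minMonoCount k (p + m * suc p) ≤ minMonoCount k p + suc p * (m * suc p)
blowUp-min k m p f rigid = minMonoCount-transfer k p _ _ (BlowUp.C k m p f)
  (λ c → BlowUp.countBound k m p f c rigid)

-- The quadratic character mod 37 (Euler's criterion): y is a nonzero square iff y¹⁸ ≡ 1.
quadraticResidue : ℕ → Bool
quadraticResidue y = (y ^ 18) % 37 ≡ᵇ 1

rigidFor? : ∀ X → Dec (∀ {r} → r < 37 → ∀ {s} → s < 37 → 0 < s → ¬ T (residuesMono 5 36 quadraticResidue r s X))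
rigidFor? X = allUpTo? (λ r → allUpTo? (λ s → (0 <? s) →-dec ¬? (T? (residuesMono 5 36 quadraticResidue r s X))) 37) 37

-- The quadratic character mod 37 is rigid for 5-APs; both decisions evaluate to yes.
quadraticResidue-rigid : Rigid 5 36 quadraticResidue
quadraticResidue-rigid false r<37 s<37 = toWitness {a? = rigidFor? false} _ r<37 s<37
quadraticResidue-rigid true  r<37 s<37 = toWitness {a? = rigidFor? true} _ r<37 s<37

toℚᵘ-/ : ∀ n d → ℚ.toℚᵘ (ℤ.+ n ℚ./ suc d) ℚᵘ.≃ mkℚᵘ (ℤ.+ n) d
toℚᵘ-/ n d = ℚP.toℚᵘ-fromℚᵘ (mkℚᵘ (ℤ.+ n) d)

rescale : ∀ p A B → A ≤ B + suc p * (36 * suc p) →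
  ℤ.+ A ℚ./ (37 * suc p * (37 * suc p)) ℚ.≤
    (ℤ.+ 36 ℚ./ 1 ℚ.+ ℤ.+ B ℚ./ (suc p * suc p)) ℚ.÷ (ℤ.+ (37 * 37) ℚ./ 1)
rescale p A B A≤ =
  ℚP.toℚᵘ-cancel-≤ (ℚᵘP.≤-respˡ-≃ (ℚᵘP.≃-sym (toℚᵘ-/ A _)) (ℚᵘP.≤-respʳ-≃ (ℚᵘP.≃-sym rhs) cross))
  where
  t t² L : ℕ
  t = suc p
  t² = t * t
  L = 37 * t * (37 * t)
  -- The right-hand side as an unnormalised fraction (36t² + B) / (37² t²), and the
  -- cross-multiplied inequality, which is the hypothesis times 37² t² up to a ring identity.
  Q : ℚᵘ.ℚᵘ
  Q = (mkℚᵘ (ℤ.+ 36) 0 ℚᵘ.+ mkℚᵘ (ℤ.+ B) (pred t²)) ℚᵘ.* mkℚᵘ (ℤ.+ 1) 1368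
  rhs : ℚ.toℚᵘ ((ℤ.+ 36 ℚ./ 1 ℚ.+ ℤ.+ B ℚ./ t²) ℚ.÷ (ℤ.+ (37 * 37) ℚ./ 1)) ℚᵘ.≃ Q
  rhs = ℚᵘP.≃-trans (ℚP.toℚᵘ-homo-* (ℤ.+ 36 ℚ./ 1 ℚ.+ ℤ.+ B ℚ./ t²) _)
          (ℚᵘP.*-congʳ (ℚᵘP.≃-trans (ℚP.toℚᵘ-homo-+ (ℤ.+ 36 ℚ./ 1) (ℤ.+ B ℚ./ t²))
                                    (ℚᵘP.+-congʳ (mkℚᵘ (ℤ.+ 36) 0) (toℚᵘ-/ B _))))
  numerator : ℚᵘ.↥ Q ≡ ℤ.+ ((36 * t² + B * 1) * 1)
  numerator = begin
    (ℤ.+ 36 ℤ.* ℤ.+ t² ℤ.+ ℤ.+ B ℤ.* ℤ.+ 1) ℤ.* ℤ.+ 1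
      ≡⟨ cong (ℤ._* ℤ.+ 1) (cong₂ ℤ._+_ (ℤP.pos-* 36 t²) (ℤP.pos-* B 1)) ⟨
    (ℤ.+ (36 * t²) ℤ.+ ℤ.+ (B * 1)) ℤ.* ℤ.+ 1
      ≡⟨ cong (ℤ._* ℤ.+ 1) (ℤP.pos-+ (36 * t²) (B * 1)) ⟨
    ℤ.+ (36 * t² + B * 1) ℤ.* ℤ.+ 1
      ≡⟨ ℤP.pos-* (36 * t² + B * 1) 1 ⟨
    ℤ.+ ((36 * t² + B * 1) * 1) ∎
    where open ≡-Reasoning
  cross-ℕ : A * ((1 * t²) * 1369) ≤ ((36 * t² + B * 1) * 1) * L
  cross-ℕ = ≤-trans (*-monoˡ-≤ ((1 * t²) * 1369) A≤) (≤-reflexive (scale t B))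
    where
    open +-*-Solver
    scale : ∀ t B → (B + t * (36 * t)) * ((1 * (t * t)) * 1369)
                      ≡ ((36 * (t * t) + B * 1) * 1) * (37 * t * (37 * t))
    scale = solve 2 (λ t B → (B :+ t :* (con 36 :* t)) :* ((con 1 :* (t :* t)) :* con 1369)
                    := ((con 36 :* (t :* t) :+ B :* con 1) :* con 1) :* (con 37 :* t :* (con 37 :* t))) refl
  cross : mkℚᵘ (ℤ.+ A) (pred L) ℚᵘ.≤ Q
  cross = ℚᵘ.*≤* (subst₂ ℤ._≤_ (ℤP.pos-* A ((1 * t²) * 1369))
                             (trans (ℤP.pos-* ((36 * t² + B * 1) * 1) L) (cong (ℤ._* ℤ.+ L) (sym numerator)))
                             (ℤ.+≤+ cross-ℕ))

lemma7 : (t : ℕ) → 2 ≤ t →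
    m 5 (37 * t) ℚ.≤ ((ℤ.+ 36 ℚ./ 1) ℚ.+ m 5 t) ℚ.÷ (ℤ.+ (37 * 37) ℚ./ 1)
lemma7 (suc p) (s≤s (s≤s z≤n)) =
  rescale p (minMonoCount 5 (p + 36 * suc p)) (minMonoCount 5 p)
    (blowUp-min 5 36 p quadraticResidue quadraticResidue-rigid)
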